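{- Let $k$ be a nonnegative integer and let $u,v,w$ be vertices of $C_{2k+1}\square C_{2k+1}$. Then $d(u,v)+d(v,w)+d(u,w)\le 2\operatorname{diam}(C_{2k+1}\square C_{2k+1})+2$.
   Context: $C_n$ is the cycle graph with vertex set $\{0,\dots,n-1\}$, distinct $v,w$ adjacent iff $v\equiv w\pm1 \pmod n$. The Cartesian product $G\square H$ has vertex set $V(G)\times V(H)$, with $(g,h)\sim(g',h')$ iff ($g=g'$ and $hh'\in E(H)$) or ($h=h'$ and $gg'\in E(G)$). $d(u,v)$ is graph distance and $\operatorname{diam}$ the maximum distance; $\operatorname{diam}(C_{2k+1}\square C_{2k+1})=2k$. -}

module Defs where

open import Data.Nat using (ℕ; zero; suc; _+_; _*_; _≤_; _%_)
open import Data.Fin using (Fin; toℕ)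
open import Data.Product using (_×_; Σ; ∃; _,_)
open import Data.Sum using (_⊎_)
open import Relation.Binary.PropositionalEquality using (_≡_; _≢_)

data Walk {V : Set} (Adj : V → V → Set) : V → V → ℕ → Set where
  here : ∀ {u} → Walk Adj u u 0
  step : ∀ {u x v n} → Adj u x → Walk Adj x v n → Walk Adj u v (suc n)

IsDist : {V : Set} → (V → V → Set) → V → V → ℕ → Set
IsDist Adj u v n = Walk Adj u v n × (∀ m → Walk Adj u v m → n ≤ m)

IsDiam : {V : Set} → (V → V → Set) → ℕ → Set
IsDiam {V} Adj D =
  (∀ u v → Σ ℕ λ n → IsDist Adj u v n × n ≤ D) ×
  Σ V λ u → Σ V λ v → IsDist Adj u v D

-- Cycle graph C_(suc m) on vertices {0,…,m}: distinct v,w adjacent iff v ≡ w ± 1 (mod suc m).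
CycleAdj : (m : ℕ) → Fin (suc m) → Fin (suc m) → Set
CycleAdj m v w =
  v ≢ w × (toℕ v ≡ (toℕ w + 1) % suc m ⊎ toℕ w ≡ (toℕ v + 1) % suc m)

BoxAdj : {A B : Set} → (A → A → Set) → (B → B → Set) → A × B → A × B → Set
BoxAdj G H (g , h) (g' , h') = (g ≡ g' × H h h') ⊎ (h ≡ h' × G g g')

TorusAdj : (k : ℕ) → Fin (suc (2 * k)) × Fin (suc (2 * k)) → Fin (suc (2 * k)) × Fin (suc (2 * k)) → Set
TorusAdj k = BoxAdj (CycleAdj (2 * k)) (CycleAdj (2 * k))

-- On a cycle of length N, any three vertices are joined pairwise by walks of
-- total length at most N: sort them and go once around the cycle.  Walks in the
-- two factors of a Cartesian product combine coordinatewise, so in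
-- C_(2k+1) □ C_(2k+1) the three distances sum to at most 2(2k+1).  For the
-- diameter, the sum of the two cyclic distances to the origin changes by at most
-- one along an edge and is 2k at (k, k), so diam ≥ 2k.
module Submission where

open import Defs
open import Data.Nat using (ℕ; zero; suc; _+_; _*_; _≤_; _<_; _∸_; _⊓_; _%_; z≤n; s≤s; s≤s⁻¹)
open import Data.Nat.Properties
open import Data.Nat.Tactic.RingSolver using (solve-∀)
open import Data.Nat.DivMod using (m<n⇒m%n≡m; n%n≡0)
open import Algebra.Properties.CommutativeSemigroup +-commutativeSemigroup
  using (xy∙z≈xz∙y; xy∙z≈zy∙x; interchange)
open import Data.Fin using (Fin; toℕ; fromℕ; fromℕ<; zero)
open import Data.Fin.Properties using (toℕ-fromℕ<; toℕ-fromℕ; toℕ-injective; toℕ<n)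
open import Data.Product using (_×_; ∃-syntax; _,_; proj₁; proj₂)
open import Data.Sum using (inj₁; inj₂)
open import Relation.Binary.Definitions using (Symmetric)
open import Relation.Binary.PropositionalEquality

module _ {V : Set} {Adj : V → V → Set} where

  _++ʷ_ : ∀ {u v w m n} → Walk Adj u v m → Walk Adj v w n → Walk Adj u w (m + n)
  here     ++ʷ q = q
  step a p ++ʷ q = step a (p ++ʷ q)

  snocʷ : ∀ {u v w n} → Walk Adj u v n → Adj v w → Walk Adj u w (suc n)
  snocʷ here       a = step a here
  snocʷ (step b p) a = step b (snocʷ p a)

  reverseʷ : Symmetric Adj → ∀ {u v n} → Walk Adj u v n → Walk Adj v u n
  reverseʷ sym-adj here       = here
  reverseʷ sym-adj (step a p) = snocʷ (reverseʷ sym-adj p) (sym-adj a)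

mapʷ : ∀ {V W : Set} {A : V → V → Set} {B : W → W → Set} (f : V → W) →
       (∀ {x y} → A x y → B (f x) (f y)) →
       ∀ {u v n} → Walk A u v n → Walk B (f u) (f v) n
mapʷ f f-adj here       = here
mapʷ f f-adj (step a p) = step (f-adj a) (mapʷ f f-adj p)

boxWalk : ∀ {A B : Set} {G : A → A → Set} {H : B → B → Set} {g g' h h' m n} →
          Walk G g g' m → Walk H h h' n → Walk (BoxAdj G H) (g , h) (g' , h') (m + n)
boxWalk {g' = g'} {h = h} p q =
  mapʷ (_, h) (λ a → inj₂ (refl , a)) p ++ʷ mapʷ (g' ,_) (λ a → inj₁ (refl , a)) q

record Triangle {V : Set} (Adj : V → V → Set) (x y z : V) (n : ℕ) : Set where
  constructor triangle
  field
    {ℓxy ℓyz ℓxz} : ℕ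
    walkxy : Walk Adj x y ℓxy
    walkyz : Walk Adj y z ℓyz
    walkxz : Walk Adj x z ℓxz
    perimeter≤ : ℓxy + ℓyz + ℓxz ≤ n

module TriangleSwap {V : Set} {Adj : V → V → Set} (sym-adj : Symmetric Adj) where

  swap₁₂ : ∀ {x y z n} → Triangle Adj x y z n → Triangle Adj y x z n
  swap₁₂ (triangle {a} {b} {c} p q r le) =
    triangle (reverseʷ sym-adj p) r q (≤-trans (≤-reflexive (xy∙z≈xz∙y a c b)) le)

  swap₂₃ : ∀ {x y z n} → Triangle Adj x y z n → Triangle Adj x z y n
  swap₂₃ (triangle {a} {b} {c} p q r le) =
    triangle r (reverseʷ sym-adj q) p (≤-trans (≤-reflexive (xy∙z≈zy∙x c b a)) le)

boxTriangle : ∀ {A B : Set} {G : A → A → Set} {H : B → B → Set} {x y z x' y' z' m n} →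
              Triangle G x y z m → Triangle H x' y' z' n →
              Triangle (BoxAdj G H) (x , x') (y , y') (z , z') (m + n)
boxTriangle (triangle {a} {b} {c} p q r le) (triangle {a'} {b'} {c'} p' q' r' le') =
  triangle (boxWalk p p') (boxWalk q q') (boxWalk r r') (begin
    a + a' + (b + b') + (c + c')  ≡⟨ cong (_+ (c + c')) (interchange a a' b b') ⟩
    a + b + (a' + b') + (c + c')  ≡⟨ interchange (a + b) (a' + b') c c' ⟩
    a + b + c + (a' + b' + c')    ≤⟨ +-mono-≤ le le' ⟩
    _                             ∎)
  where open ≤-Reasoning

Triangle⇒dist-sum≤ : ∀ {V : Set} {Adj : V → V → Set} {u v w a b c n} →
                     IsDist Adj u v a → IsDist Adj v w b → IsDist Adj u w c →
                     Triangle Adj u v w n → a + b + c ≤ n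
Triangle⇒dist-sum≤ (_ , a-min) (_ , b-min) (_ , c-min) (triangle p q r le) =
  ≤-trans (+-mono-≤ (+-mono-≤ (a-min _ p) (b-min _ q)) (c-min _ r)) le

Lipschitz : {V : Set} → (V → V → Set) → (V → ℕ) → Set
Lipschitz Adj f = ∀ {x y} → Adj x y → f x ≤ suc (f y)

module _ {V : Set} {Adj : V → V → Set} {f : V → ℕ} (f-lip : Lipschitz Adj f) where

  Lipschitz-walk : ∀ {u v n} → Walk Adj u v n → f u ≤ n + f v
  Lipschitz-walk here       = ≤-refl
  Lipschitz-walk (step a p) = ≤-trans (f-lip a) (s≤s (Lipschitz-walk p))

  Lipschitz-diam : ∀ {D} → IsDiam Adj D → ∀ u v → f u ≤ D + f v
  Lipschitz-diam (dist≤D , _) u v with dist≤D u v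
  ... | n , (p , _) , n≤D = ≤-trans (Lipschitz-walk p) (+-monoˡ-≤ (f v) n≤D)

boxLipschitz : ∀ {A B : Set} {G : A → A → Set} {H : B → B → Set} {f : A → ℕ} {g : B → ℕ} →
               Lipschitz G f → Lipschitz H g →
               Lipschitz (BoxAdj G H) (λ (a , b) → f a + g b)
boxLipschitz {f = f} f-lip g-lip {a , _} (inj₁ (refl , e)) =
  ≤-trans (+-monoʳ-≤ (f a) (g-lip e)) (≤-reflexive (+-suc (f a) _))
boxLipschitz {g = g} f-lip g-lip {_ , b} (inj₂ (refl , e)) = +-monoˡ-≤ (g b) (f-lip e)

module Cycle (m : ℕ) where

  Cyc : Set
  Cyc = Fin (suc m)

  cycle-sym : Symmetric (CycleAdj m)
  cycle-sym (x≢y , inj₁ e) = (λ y≡x → x≢y (sym y≡x)) , inj₂ e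
  cycle-sym (x≢y , inj₂ e) = (λ y≡x → x≢y (sym y≡x)) , inj₁ e

  successor-adj : ∀ {x y : Cyc} → toℕ y ≡ suc (toℕ x) → CycleAdj m x y
  successor-adj {x} {y} y≡1+x =
    (λ x≡y → 1+n≢n (sym (trans (cong toℕ x≡y) y≡1+x))) ,
    inj₂ (trans y≡1+x (trans (+-comm 1 (toℕ x)) (sym (m<n⇒m%n≡m 1+x<1+m))))
    where
    1+x<1+m : toℕ x + 1 < suc m
    1+x<1+m = subst (_< suc m) (trans y≡1+x (+-comm 1 (toℕ x))) (toℕ<n y)

  [m+1]%[1+m]≡0 : (m + 1) % suc m ≡ 0
  [m+1]%[1+m]≡0 = trans (cong (_% suc m) (+-comm m 1)) (n%n≡0 (suc m))

  wrap-adj : 0 < m → CycleAdj m (fromℕ m) zero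
  wrap-adj 0<m =
    (λ top≡0 → <⇒≢ 0<m (sym (trans (sym (toℕ-fromℕ m)) (cong toℕ top≡0)))) ,
    inj₂ (sym (trans (cong (λ t → (t + 1) % suc m) (toℕ-fromℕ m)) [m+1]%[1+m]≡0))

  ascending-walk : ∀ d {x y : Cyc} → toℕ y ≡ toℕ x + d → Walk (CycleAdj m) x y d
  ascending-walk zero {x} {y} y≡x+0
    with toℕ-injective (trans (sym (+-identityʳ (toℕ x))) (sym y≡x+0))
  ... | refl = here
  ascending-walk (suc d) {x} {y} y≡x+1+d =
    step (successor-adj (toℕ-fromℕ< 1+x<1+m))
         (ascending-walk d (trans y≡1+x+d (cong (_+ d) (sym (toℕ-fromℕ< 1+x<1+m)))))
    where
    y≡1+x+d : toℕ y ≡ suc (toℕ x) + d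
    y≡1+x+d = trans y≡x+1+d (+-suc (toℕ x) d)
    1+x<1+m : suc (toℕ x) < suc m
    1+x<1+m = ≤-<-trans (≤-trans (m≤m+n (suc (toℕ x)) d) (≤-reflexive (sym y≡1+x+d))) (toℕ<n y)

  -- For x < z: up from z to the top vertex m, across the edge m — 0, then up to x.
  closing-walk : ∀ d {x z : Cyc} → toℕ z ≡ toℕ x + d →
                 ∃[ ℓ ] Walk (CycleAdj m) z x ℓ × d + ℓ ≤ suc m
  closing-walk zero {x} {z} z≡x+0 =
    0 , reverseʷ cycle-sym (ascending-walk 0 z≡x+0) , z≤n
  closing-walk (suc d) {x} {z} z≡x+1+d =
    e + suc (toℕ x) ,
    ascending-walk e (trans (toℕ-fromℕ m) (sym z+e≡m))
      ++ʷ step (wrap-adj 0<m) (ascending-walk (toℕ x) refl) ,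
    ≤-reflexive perimeter
    where
    z≤m : toℕ z ≤ m
    z≤m = s≤s⁻¹ (toℕ<n z)
    e : ℕ
    e = m ∸ toℕ z
    z+e≡m : toℕ z + e ≡ m
    z+e≡m = m+[n∸m]≡n z≤m
    0<m : 0 < m
    0<m = ≤-trans (≤-trans (s≤s z≤n) (≤-trans (m≤n+m (suc d) (toℕ x)) (≤-reflexive (sym z≡x+1+d)))) z≤m
    perimeter : suc d + (e + suc (toℕ x)) ≡ suc m
    perimeter = begin
      suc d + (e + suc (toℕ x))  ≡⟨ rearrange d e (toℕ x) ⟩
      suc (toℕ x + suc d + e)    ≡⟨ cong (λ t → suc (t + e)) (sym z≡x+1+d) ⟩
      suc (toℕ z + e)            ≡⟨ cong suc z+e≡m ⟩
      suc m                      ∎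
      where
      open ≡-Reasoning
      rearrange : ∀ a b c → suc a + (b + suc c) ≡ suc (c + suc a + b)
      rearrange = solve-∀

  sorted-triangle : ∀ {x y z : Cyc} → toℕ x ≤ toℕ y → toℕ y ≤ toℕ z → Triangle (CycleAdj m) x y z (suc m)
  sorted-triangle {x} {y} {z} x≤y y≤z with m≤n⇒∃[o]m+o≡n x≤y | m≤n⇒∃[o]m+o≡n y≤z
  ... | d₁ , x+d₁≡y | d₂ , y+d₂≡z with closing-walk (d₁ + d₂) z≡x+d₁+d₂
    where
    z≡x+d₁+d₂ : toℕ z ≡ toℕ x + (d₁ + d₂)
    z≡x+d₁+d₂ = trans (sym y+d₂≡z) (trans (cong (_+ d₂) (sym x+d₁≡y)) (+-assoc (toℕ x) d₁ d₂))
  ... | _ , walkzx , d₁+d₂+ℓ≤1+m =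
    triangle (ascending-walk d₁ (sym x+d₁≡y)) (ascending-walk d₂ (sym y+d₂≡z))
             (reverseʷ cycle-sym walkzx) d₁+d₂+ℓ≤1+m

  open TriangleSwap {Adj = CycleAdj m} cycle-sym

  cycle-triangle : ∀ (x y z : Cyc) → Triangle (CycleAdj m) x y z (suc m)
  cycle-triangle x y z with ≤-total (toℕ x) (toℕ y) | ≤-total (toℕ y) (toℕ z) | ≤-total (toℕ x) (toℕ z)
  ... | inj₁ x≤y | inj₁ y≤z | _        = sorted-triangle x≤y y≤z
  ... | inj₁ x≤y | inj₂ z≤y | inj₁ x≤z = swap₂₃ (sorted-triangle x≤z z≤y)
  ... | inj₁ x≤y | inj₂ z≤y | inj₂ z≤x = swap₂₃ (swap₁₂ (sorted-triangle z≤x x≤y))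
  ... | inj₂ y≤x | _        | inj₁ x≤z = swap₁₂ (sorted-triangle y≤x x≤z)
  ... | inj₂ y≤x | inj₁ y≤z | inj₂ z≤x = swap₁₂ (swap₂₃ (sorted-triangle y≤z z≤x))
  ... | inj₂ y≤x | inj₂ z≤y | inj₂ _   = swap₁₂ (swap₂₃ (swap₁₂ (sorted-triangle z≤y y≤x)))

  distToZero : ℕ → ℕ
  distToZero i = i ⊓ (suc m ∸ i)

  distToZero-suc≤ : ∀ i → distToZero (suc i) ≤ suc (distToZero i)
  distToZero-suc≤ i = ⊓-monoʳ-≤ (suc i) (≤-trans (∸-monoˡ-≤ i (n≤1+n m)) (n≤1+n (suc m ∸ i)))

  distToZero≤suc : ∀ i → distToZero i ≤ suc (distToZero (suc i))
  distToZero≤suc i = ⊓-mono-≤ (≤-trans (n≤1+n i) (n≤1+n (suc i))) 1+m∸i≤1+[m∸i]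
    where
    1+m∸i≤1+[m∸i] : suc m ∸ i ≤ suc (m ∸ i)
    1+m∸i≤1+[m∸i] = m≤n+o⇒m∸n≤o (suc m) i (≤-trans (s≤s (m≤n+m∸n m i)) (≤-reflexive (sym (+-suc i (m ∸ i)))))

  distToZero-top≤1 : distToZero m ≤ 1
  distToZero-top≤1 = ≤-trans (m⊓n≤n m (suc m ∸ m)) (≤-reflexive (m+n∸n≡m 1 m))

  distToZero-successor : ∀ {i j} → i < suc m → j ≡ (i + 1) % suc m →
                         distToZero j ≤ suc (distToZero i) × distToZero i ≤ suc (distToZero j)
  distToZero-successor {i} i<1+m refl with m≤n⇒m<n∨m≡n (s≤s⁻¹ i<1+m)
  ... | inj₁ i<m rewrite m<n⇒m%n≡m (subst (_< suc m) (+-comm 1 i) (s≤s i<m)) | +-comm i 1 =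
    distToZero-suc≤ i , distToZero≤suc i
  ... | inj₂ i≡m rewrite i≡m | [m+1]%[1+m]≡0 = z≤n , distToZero-top≤1

  distToZero-Lipschitz : Lipschitz (CycleAdj m) (λ x → distToZero (toℕ x))
  distToZero-Lipschitz {x} {y} (_ , inj₁ x≡y+1) = proj₁ (distToZero-successor (toℕ<n y) x≡y+1)
  distToZero-Lipschitz {x} {y} (_ , inj₂ y≡x+1) = proj₂ (distToZero-successor (toℕ<n x) y≡x+1)

module Torus (k : ℕ) where
  open Cycle (2 * k)

  torus-triangle : ∀ u v w → Triangle (TorusAdj k) u v w (suc (2 * k) + suc (2 * k))
  torus-triangle (x , x') (y , y') (z , z') = boxTriangle (cycle-triangle x y z) (cycle-triangle x' y' z')

  torus-distToZero-Lipschitz : Lipschitz (TorusAdj k) (λ (x , y) → distToZero (toℕ x) + distToZero (toℕ y))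
  torus-distToZero-Lipschitz =
    boxLipschitz {G = CycleAdj (2 * k)} {H = CycleAdj (2 * k)} distToZero-Lipschitz distToZero-Lipschitz

  torus-diam≥ : ∀ {D} → IsDiam (TorusAdj k) D → 2 * k ≤ D
  torus-diam≥ {D} diam = begin
    2 * k                                  ≡⟨ cong (k +_) (+-identityʳ k) ⟩
    k + k                                  ≤⟨ +-mono-≤ k≤distToZero-centre k≤distToZero-centre ⟩
    distToZero (toℕ centre) + distToZero (toℕ centre)
                                           ≤⟨ Lipschitz-diam torus-distToZero-Lipschitz diam (centre , centre) (zero , zero) ⟩
    D + 0                                  ≡⟨ +-identityʳ D ⟩
    D                                      ∎
    where
    open ≤-Reasoning
    k<1+2k : k < suc (2 * k)
    k<1+2k = s≤s (m≤m+n k (k + 0))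
    centre : Fin (suc (2 * k))
    centre = fromℕ< k<1+2k
    k≤distToZero-centre : k ≤ distToZero (toℕ centre)
    k≤distToZero-centre rewrite toℕ-fromℕ< k<1+2k =
      ⊓-glb ≤-refl (m+n≤o⇒m≤o∸n k (≤-trans (+-monoʳ-≤ k (m≤m+n k 0)) (n≤1+n (2 * k))))

lemma2p4 : (k : ℕ) → (u v w : Fin (suc (2 * k)) × Fin (suc (2 * k))) →
    (a b c D : ℕ) →
    IsDist (TorusAdj k) u v a → IsDist (TorusAdj k) v w b →
    IsDist (TorusAdj k) u w c → IsDiam (TorusAdj k) D →
    a + b + c ≤ 2 * D + 2
lemma2p4 k u v w a b c D uv vw uw diam = begin
  a + b + c                  ≤⟨ Triangle⇒dist-sum≤ uv vw uw (torus-triangle u v w) ⟩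
  suc (2 * k) + suc (2 * k)  ≡⟨ double-odd (2 * k) ⟩
  2 * (2 * k) + 2            ≤⟨ +-monoˡ-≤ 2 (*-monoʳ-≤ 2 (torus-diam≥ diam)) ⟩
  2 * D + 2                  ∎
  where
  open Torus k
  open ≤-Reasoning
  double-odd : ∀ n → suc n + suc n ≡ 2 * n + 2
  double-odd = solve-∀
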